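{- Let $G=(V,E)$ and $G'=(V',E')$ be graphs, let $\mathcal{S}$ be a set of distributions on $G$ and $\mathcal{S}'$ a set of distributions on $G'$. If $D$ is an $\mathcal{S}$-solvable distribution on $G$ and $D'$ is an $\mathcal{S}'$-solvable distribution on $G'$, then $D\cdot D'$ is an $(\mathcal{S}\cdot\mathcal{S}')$-solvable distribution on $G\Box G'$. In particular, $\pi^*(G\Box G',\mathcal{S}\cdot\mathcal{S}')\le \pi^*(G,\mathcal{S})\,\pi^*(G',\mathcal{S}')$.
   Context: Graphs are finite simple graphs. A distribution on a graph $G=(V,E)$ is a function $D:V\to\mathbb{N}$ (number of pebbles on each vertex), with size $|D|=\sum_{v\in V}D(v)$. $D$ contains $D'$ if $D'(v)\le D(v)$ for all $v$. A pebbling move removes two pebbles from a vertex having at least two pebbles and places one pebble on a neighbor of that vertex. $D_2$ is reachable from $D_1$ if some sequence of pebbling moves starting from $D_1$ results in a distribution containing $D_2$. For a set $\mathcal{S}$ of distributions on $G$, $D$ is $\mathcal{S}$-solvable if every distribution in $\mathcal{S}$ is reachable from $D$; $\pi^*(G,\mathcal{S})$ is the smallest size of an $\mathcal{S}$-solvable distribution on $G$. The Cartesian product $G\Box G'$ has vertex set $V\times V'$, with $(x,x')$ adjacent to $(y,x')$ when $xy\in E$ and $(x,x')$ adjacent to $(x,y')$ when $x'y'\in E'$. For distributions $D$ on $G$ and $D'$ on $G'$, $D\cdot D'$ is the distribution on $G\Box G'$ with $(D\cdot D')((x,x'))=D(x)D'(x')$; for sets of distributions, $\mathcal{S}\cdot\mathcal{S}'=\{D\cdot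 D': D\in\mathcal{S}, D'\in\mathcal{S}'\}$. -}

module Defs where

open import Level using (0ℓ)
open import Data.Nat using (ℕ; _+_; _*_; _≤_)
open import Data.Fin using (Fin)
open import Data.Fin.Properties using (*↔×)
open import Data.Product using (Σ; ∃; ∃-syntax; _×_; _,_; proj₁; proj₂)
open import Data.Sum using (_⊎_)
open import Data.Empty using (⊥)
open import Relation.Nullary using (¬_)
open import Relation.Binary.PropositionalEquality using (_≡_; _≢_)
open import Relation.Binary.Construct.Closure.ReflexiveTransitive using (Star)
open import Function.Bundles using (_↔_; Inverse)
open import Function.Properties.Inverse using (↔-trans)
open import Data.Product.Function.NonDependent.Propositional using (_×-↔_)
open import Data.Vec.Functional using () renaming (foldr to vfoldr)

record Graph : Set₁ where
  field
    V       : Set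
    order   : ℕ
    enum    : Fin order ↔ V
    Adj     : V → V → Set
    symAdj  : ∀ {x y} → Adj x y → Adj y x
    irrAdj  : ∀ {x} → ¬ Adj x x

open Graph public

Dist : Graph → Set
Dist G = V G → ℕ

size : (G : Graph) → Dist G → ℕ
size G D = vfoldr _+_ 0 (λ i → D (Inverse.to (enum G) i))

_⊒_ : {G : Graph} → Dist G → Dist G → Set
_⊒_ {G} D D′ = ∀ (v : V G) → D′ v ≤ D v

data Move (G : Graph) (D D′ : Dist G) : Set where
  move : (u v : V G) → Adj G u v →
         D′ u + 2 ≡ D u →
         D′ v ≡ D v + 1 →
         (∀ w → w ≢ u → w ≢ v → D′ w ≡ D w) →
         Move G D D′

Reachable : (G : Graph) → Dist G → Dist G → Set
Reachable G D₁ D₂ = Σ (Dist G) λ D₃ → Star (Move G) D₁ D₃ × (_⊒_ {G} D₃ D₂)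

DistSet : Graph → Set₁
DistSet G = Dist G → Set

Solvable : (G : Graph) → DistSet G → Dist G → Set
Solvable G S D = ∀ T → S T → Reachable G D T

IsPebblingNumber : (G : Graph) → DistSet G → ℕ → Set
IsPebblingNumber G S k =
  (∃[ D ] (Solvable G S D × size G D ≡ k)) × (∀ D → Solvable G S D → k ≤ size G D)

_□_ : Graph → Graph → Graph
G □ H = record
  { V      = V G × V H
  ; order  = order G * order H
  ; enum   = ↔-trans (*↔× {order G} {order H}) (enum G ×-↔ enum H)
  ; Adj    = PAdj
  ; symAdj = psym
  ; irrAdj = pirr
  }
  where
  PAdj : V G × V H → V G × V H → Set
  PAdj (x , x′) (y , y′) = (Adj G x y × x′ ≡ y′) ⊎ (x ≡ y × Adj H x′ y′)
  open import Relation.Binary.PropositionalEquality using (sym; refl)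
  psym : ∀ {p q} → PAdj p q → PAdj q p
  psym (Data.Sum.inj₁ (a , e)) = Data.Sum.inj₁ (symAdj G a , sym e)
  psym (Data.Sum.inj₂ (e , a)) = Data.Sum.inj₂ (sym e , symAdj H a)
  pirr : ∀ {p} → ¬ PAdj p p
  pirr (Data.Sum.inj₁ (a , _)) = irrAdj G a
  pirr (Data.Sum.inj₂ (_ , a)) = irrAdj H a

_·_ : {G H : Graph} → Dist G → Dist H → Dist (G □ H)
(D · D′) (x , x′) = D x * D′ x′

_⊙_ : {G H : Graph} → DistSet G → DistSet H → DistSet (G □ H)
_⊙_ {G} {H} S S′ T =
  ∃[ D ] ∃[ D′ ] (S D × S′ D′ × (∀ p → T p ≡ (_·_ {G} {H} D D′) p))

-- D · D′ is the sum, over the vertices y of G′, of D′ y copies of D placed on the fibre G × {y}.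
-- A solution of a target A from D, replayed in every fibre (once per copy), is a sequence of moves
-- from D · D′ to E · D′ with E ⊒ A; replaying a solution of A′ from D′ in the fibres {x} × G′
-- then reaches E · E′ ⊒ A · A′. Since |D · D′| = |D| |D′|, the bound on π* follows.

module Submission where

open import Defs
open import Data.Nat using (ℕ; zero; suc; _+_; _*_; _≤_)
open import Data.Nat.Properties
  using (+-*-semiring; +-commutativeSemigroup; +-assoc; +-comm; +-identityʳ; *-zeroʳ; *-comm; *-mono-≤)
open import Data.Fin using (Fin; zero; suc; _↑ˡ_; _↑ʳ_; combine)
open import Data.Fin.Properties using (remQuot-combine; inj⇒≟; 0≢1+n; suc-injective)
open import Data.Product using (_×_; _,_; swap; ∃-syntax)
open import Data.Sum using (inj₁; inj₂)
open import Data.Vec.Functional using (Vector)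
open import Function using (_∘_)
open import Function.Bundles using (Inverse)
open import Function.Properties.Inverse using (↔⇒↣; ↔-sym)
open import Relation.Binary.Definitions using (DecidableEquality)
open import Relation.Binary.PropositionalEquality
open import Relation.Nullary using (yes; no; contradiction)
open import Relation.Binary.Construct.Closure.ReflexiveTransitive
  using (Star; ε; _◅_; _◅◅_; gmap)
open import Algebra.Properties.Semiring.Sum +-*-semiring
  using (sum; sum-cong-≗; sum-replicate-zero; *-distribˡ-sum; *-distribʳ-sum)
open import Algebra.Properties.CommutativeSemigroup +-commutativeSemigroup
  using (xy∙z≈xz∙y)

sum-↑ : ∀ m n (g : Vector ℕ (m + n)) → sum g ≡ sum (g ∘ (_↑ˡ n)) + sum (g ∘ (m ↑ʳ_))
sum-↑ zero    n g = refl
sum-↑ (suc m) n g = begin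
  g zero + sum (g ∘ suc)                                       ≡⟨ cong (g zero +_) (sum-↑ m n (g ∘ suc)) ⟩
  g zero + (sum (g ∘ suc ∘ (_↑ˡ n)) + sum (g ∘ suc ∘ (m ↑ʳ_))) ≡⟨ sym (+-assoc (g zero) _ _) ⟩
  g zero + sum (g ∘ suc ∘ (_↑ˡ n)) + sum (g ∘ suc ∘ (m ↑ʳ_))   ∎
  where open ≡-Reasoning

sum-combine : ∀ m n (g : Vector ℕ (m * n)) → sum g ≡ sum (λ (a : Fin m) → sum (λ (b : Fin n) → g (combine a b)))
sum-combine zero    n g = refl
sum-combine (suc m) n g =
  trans (sum-↑ n (m * n) g) (cong (sum (λ b → g (b ↑ˡ (m * n))) +_) (sum-combine m n (g ∘ (n ↑ʳ_))))

sum-single : ∀ {n} (h : Vector ℕ n) j → (∀ i → i ≢ j → h i ≡ 0) → sum h ≡ h j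
sum-single {suc n} h zero    h≡0 = begin
  h zero + sum (h ∘ suc)     ≡⟨ cong (h zero +_) (sum-cong-≗ (λ i → h≡0 (suc i) (0≢1+n ∘ sym))) ⟩
  h zero + sum {n} (λ _ → 0) ≡⟨ cong (h zero +_) (sum-replicate-zero n) ⟩
  h zero + 0                 ≡⟨ +-identityʳ (h zero) ⟩
  h zero                     ∎
  where open ≡-Reasoning
sum-single h (suc j) h≡0 =
  cong₂ _+_ (h≡0 zero 0≢1+n) (sum-single (h ∘ suc) j (λ i i≢j → h≡0 (suc i) (i≢j ∘ suc-injective)))

sum-enum-single : (K : Graph) (g : V K → ℕ) (y : V K) → (∀ z → z ≢ y → g z ≡ 0) →
  sum (g ∘ Inverse.to (enum K)) ≡ g y
sum-enum-single K g y g≡0 =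
  trans (sum-single (g ∘ to) (from y) λ i i≢ → g≡0 (to i) λ eq →
           i≢ (trans (sym (strictlyInverseʳ i)) (cong from eq)))
        (cong g (strictlyInverseˡ y))
  where open Inverse (enum K)

size-· : (G H : Graph) (D : Dist G) (D′ : Dist H) →
  size (G □ H) (_·_ {G} {H} D D′) ≡ size G D * size H D′
size-· G H D D′ = begin
  size (G □ H) (_·_ {G} {H} D D′)                 ≡⟨ sum-combine m n f ⟩
  sum (λ a → sum (λ b → f (combine {m} {n} a b))) ≡⟨ sum-cong-≗ (λ a → sum-cong-≗ (λ b → cong g (remQuot-combine a b))) ⟩
  sum (λ a → sum (λ b → d a * d′ b))               ≡⟨ sum-cong-≗ (λ a → sym (*-distribˡ-sum (d a) d′)) ⟩
  sum (λ a → d a * size H D′)                      ≡⟨ sym (*-distribʳ-sum (size H D′) d) ⟩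
  size G D * size H D′                             ∎
  where
  open ≡-Reasoning
  m n : ℕ
  m = order G
  n = order H
  d : Vector ℕ m
  d = D ∘ Inverse.to (enum G)
  d′ : Vector ℕ n
  d′ = D′ ∘ Inverse.to (enum H)
  f : Fin (m * n) → ℕ
  f i = _·_ {G} {H} D D′ (Inverse.to (enum (G □ H)) i)
  g : Fin m × Fin n → ℕ
  g (a , b) = d a * d′ b

infixl 6 _⊕_
infixr 7 _⊛_
infix 4 _⊢_⇝_

_⊕_ : {A : Set} → (A → ℕ) → (A → ℕ) → A → ℕ
(D ⊕ E) v = D v + E v

_⊛_ : {A : Set} → ℕ → (A → ℕ) → A → ℕ
(c ⊛ D) v = c * D v

⨁ : {A : Set} {n : ℕ} → (Fin n → A → ℕ) → A → ℕ
⨁ Ds v = sum (λ i → Ds i v)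

-- Reachability up to pointwise equality: the decompositions of distributions used below hold only pointwise.
_⊢_⇝_ : (K : Graph) → Dist K → Dist K → Set
K ⊢ D ⇝ E = ∃[ F ] (Star (Move K) D F × F ≗ E)

module _ {K : Graph} where

  Move-cong : ∀ {D D′ E E′ : Dist K} → D′ ≗ D → E ≗ E′ → Move K D E → Move K D′ E′
  Move-cong D′≗D E≗E′ (move u v uv eᵤ eᵥ eₒ) =
    move u v uv
      (trans (cong (_+ 2) (sym (E≗E′ u))) (trans eᵤ (sym (D′≗D u))))
      (trans (sym (E≗E′ v)) (trans eᵥ (cong (_+ 1) (sym (D′≗D v)))))
      (λ w w≢u w≢v → trans (sym (E≗E′ w)) (trans (eₒ w w≢u w≢v) (sym (D′≗D w))))

  Move-frame : ∀ {D E : Dist K} (F : Dist K) → Move K D E → Move K (D ⊕ F) (E ⊕ F)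
  Move-frame F (move u v uv eᵤ eᵥ eₒ) =
    move u v uv
      (trans (xy∙z≈xz∙y _ (F u) 2) (cong (_+ F u) eᵤ))
      (trans (cong (_+ F v) eᵥ) (sym (xy∙z≈xz∙y _ (F v) 1)))
      (λ w w≢u w≢v → cong (_+ F w) (eₒ w w≢u w≢v))

  ⇝-star : ∀ {D E : Dist K} → Star (Move K) D E → K ⊢ D ⇝ E
  ⇝-star s = _ , s , λ _ → refl

  ⇝-refl : ∀ {D : Dist K} → K ⊢ D ⇝ D
  ⇝-refl = ⇝-star ε

  ⇝-cong : ∀ {D D′ E E′ : Dist K} → D′ ≗ D → E ≗ E′ → K ⊢ D ⇝ E → K ⊢ D′ ⇝ E′
  ⇝-cong D′≗D E≗E′ (F , ε , F≗E) = _ , ε , λ v → trans (D′≗D v) (trans (F≗E v) (E≗E′ v))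
  ⇝-cong D′≗D E≗E′ (F , m ◅ s , F≗E) =
    F , Move-cong D′≗D (λ _ → refl) m ◅ s , λ v → trans (F≗E v) (E≗E′ v)

  ⇝-trans : ∀ {D E F : Dist K} → K ⊢ D ⇝ E → K ⊢ E ⇝ F → K ⊢ D ⇝ F
  ⇝-trans (E′ , s , E′≗E) E⇝F with ⇝-cong E′≗E (λ _ → refl) E⇝F
  ... | F′ , s′ , F′≗F = F′ , s ◅◅ s′ , F′≗F

  ⇝-frame : ∀ {D E : Dist K} (F : Dist K) → K ⊢ D ⇝ E → K ⊢ D ⊕ F ⇝ E ⊕ F
  ⇝-frame F (E′ , s , E′≗E) = E′ ⊕ F , gmap (_⊕ F) (Move-frame F) s , λ v → cong (_+ F v) (E′≗E v)

  ⇝-⊕ : ∀ {D₁ D₂ E₁ E₂ : Dist K} → K ⊢ D₁ ⇝ E₁ → K ⊢ D₂ ⇝ E₂ → K ⊢ D₁ ⊕ D₂ ⇝ E₁ ⊕ E₂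
  ⇝-⊕ {D₂ = D₂} {E₁ = E₁} D₁⇝E₁ D₂⇝E₂ =
    ⇝-trans (⇝-frame D₂ D₁⇝E₁)
            (⇝-cong (λ v → +-comm (E₁ v) (D₂ v)) (λ v → +-comm _ (E₁ v)) (⇝-frame E₁ D₂⇝E₂))

  ⇝-⊛ : ∀ {D E : Dist K} c → K ⊢ D ⇝ E → K ⊢ c ⊛ D ⇝ c ⊛ E
  ⇝-⊛ zero    D⇝E = ⇝-refl
  ⇝-⊛ (suc c) D⇝E = ⇝-⊕ D⇝E (⇝-⊛ c D⇝E)

  ⇝-⨁ : ∀ {n} {Ds Es : Fin n → Dist K} → (∀ i → K ⊢ Ds i ⇝ Es i) → K ⊢ ⨁ Ds ⇝ ⨁ Es
  ⇝-⨁ {zero}  Ds⇝Es = ⇝-refl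
  ⇝-⨁ {suc n} Ds⇝Es = ⇝-⊕ (Ds⇝Es zero) (⇝-⨁ (Ds⇝Es ∘ suc))

≟-V : (K : Graph) → DecidableEquality (V K)
≟-V K = inj⇒≟ (↔⇒↣ (↔-sym (enum K)))

module _ (G H : Graph) where

  private
    _≟_ : DecidableEquality (V H)
    _≟_ = ≟-V H
    ys : Fin (order H) → V H
    ys = Inverse.to (enum H)

  fibre : V H → Dist G → Dist (G □ H)
  fibre y d (x , y′) with y′ ≟ y
  ... | yes _ = d x
  ... | no  _ = 0

  fibre-on : ∀ {y} (d : Dist G) x → fibre y d (x , y) ≡ d x
  fibre-on {y} d x with y ≟ y
  ... | yes _  = refl
  ... | no y≢y = contradiction refl y≢y

  fibre-off : ∀ {y y′} (d : Dist G) x → y′ ≢ y → fibre y d (x , y′) ≡ 0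
  fibre-off {y} {y′} d x y′≢y with y′ ≟ y
  ... | yes y′≡y = contradiction y′≡y y′≢y
  ... | no  _    = refl

  Move-fibre : ∀ {d e : Dist G} y → Move G d e → Move (G □ H) (fibre y d) (fibre y e)
  Move-fibre {d} {e} y (move u v uv eᵤ eᵥ eₒ) =
    move (u , y) (v , y) (inj₁ (uv , refl))
      (trans (cong (_+ 2) (fibre-on e u)) (trans eᵤ (sym (fibre-on d u))))
      (trans (fibre-on e v) (trans eᵥ (cong (_+ 1) (sym (fibre-on d v)))))
      others
    where
    others : ∀ p → p ≢ (u , y) → p ≢ (v , y) → fibre y e p ≡ fibre y d p
    others (x , y′) p≢u p≢v with y′ ≟ y
    ... | yes refl = eₒ x (p≢u ∘ cong (_, y)) (p≢v ∘ cong (_, y))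
    ... | no  _    = refl

  ·-≗-⨁-fibre : (d : Dist G) (w : Dist H) →
    _·_ {G} {H} d w ≗ ⨁ (λ i → w (ys i) ⊛ fibre (ys i) d)
  ·-≗-⨁-fibre d w (x , y′) = sym (begin
    sum (λ i → w (ys i) * fibre (ys i) d (x , y′)) ≡⟨ sum-enum-single H (λ y → w y * fibre y d (x , y′)) y′ off-y′ ⟩
    w y′ * fibre y′ d (x , y′)                      ≡⟨ cong (w y′ *_) (fibre-on d x) ⟩
    w y′ * d x                                      ≡⟨ *-comm (w y′) (d x) ⟩
    d x * w y′                                      ∎)
    where
    open ≡-Reasoning
    off-y′ : ∀ y → y ≢ y′ → w y * fibre y d (x , y′) ≡ 0
    off-y′ y y≢y′ = trans (cong (w y *_) (fibre-off d x (y≢y′ ∘ sym))) (*-zeroʳ (w y))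

  ⇝-liftˡ : ∀ {d e : Dist G} → Star (Move G) d e → (w : Dist H) →
    G □ H ⊢ _·_ {G} {H} d w ⇝ _·_ {G} {H} e w
  ⇝-liftˡ {d} {e} s w =
    ⇝-cong (·-≗-⨁-fibre d w) (sym ∘ ·-≗-⨁-fibre e w)
      (⇝-⨁ λ i → ⇝-⊛ (w (ys i)) (⇝-star (gmap (fibre (ys i)) (Move-fibre (ys i)) s)))

Move-swap : (G H : Graph) {D E : Dist (H □ G)} → Move (H □ G) D E → Move (G □ H) (D ∘ swap) (E ∘ swap)
Move-swap G H (move (u′ , u) (v′ , v) uv eᵤ eᵥ eₒ) =
  move (u , u′) (v , v′) (swap-adj uv) eᵤ eᵥ (λ p p≢u p≢v → eₒ (swap p) (p≢u ∘ cong swap) (p≢v ∘ cong swap))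
  where
  swap-adj : Adj (H □ G) (u′ , u) (v′ , v) → Adj (G □ H) (u , u′) (v , v′)
  swap-adj (inj₁ (a , e)) = inj₂ (e , a)
  swap-adj (inj₂ (e , a)) = inj₁ (a , e)

⇝-swap : (G H : Graph) {D E : Dist (H □ G)} → H □ G ⊢ D ⇝ E → G □ H ⊢ D ∘ swap ⇝ E ∘ swap
⇝-swap G H (F , s , F≗E) = F ∘ swap , gmap (_∘ swap) (Move-swap G H) s , F≗E ∘ swap

⇝-liftʳ : (G H : Graph) {d e : Dist H} → Star (Move H) d e → (w : Dist G) →
  G □ H ⊢ _·_ {G} {H} w d ⇝ _·_ {G} {H} w e
⇝-liftʳ G H s w =
  ⇝-cong (λ (x , y) → *-comm (w x) _) (λ (x , y) → *-comm _ (w x)) (⇝-swap G H (⇝-liftˡ H G s w))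

·-solvable : (G H : Graph) (S : DistSet G) (S′ : DistSet H) (D : Dist G) (D′ : Dist H) →
  Solvable G S D → Solvable H S′ D′ → Solvable (G □ H) (_⊙_ {G} {H} S S′) (_·_ {G} {H} D D′)
·-solvable G H S S′ D D′ solD solD′ T (A , A′ , A∈S , A′∈S′ , T≗A·A′)
  with solD A A∈S | solD′ A′ A′∈S′
... | E , D→E , E⊒A | E′ , D′→E′ , E′⊒A′
  with ⇝-trans (⇝-liftˡ G H D→E D′) (⇝-liftʳ G H D′→E′ E)
... | F , s , F≗E·E′ =
  F , s , λ (x , y) → subst₂ _≤_ (sym (T≗A·A′ (x , y))) (sym (F≗E·E′ (x , y))) (*-mono-≤ (E⊒A x) (E′⊒A′ y))

theorem2p3 : (G G′ : Graph) (S : DistSet G) (S′ : DistSet G′) →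
    ((D : Dist G) (D′ : Dist G′) → Solvable G S D → Solvable G′ S′ D′ →
      Solvable (G □ G′) (_⊙_ {G} {G′} S S′) (_·_ {G} {G′} D D′))
    × ((k k′ j : ℕ) → IsPebblingNumber G S k → IsPebblingNumber G′ S′ k′ →
      IsPebblingNumber (G □ G′) (_⊙_ {G} {G′} S S′) j → j ≤ k * k′)
theorem2p3 G G′ S S′ = ·-solvable G G′ S S′ , bound
  where
  bound : (k k′ j : ℕ) → IsPebblingNumber G S k → IsPebblingNumber G′ S′ k′ →
    IsPebblingNumber (G □ G′) (_⊙_ {G} {G′} S S′) j → j ≤ k * k′
  bound k k′ j ((D , solD , refl) , _) ((D′ , solD′ , refl) , _) (_ , j-minimal) =
    subst (j ≤_) (size-· G G′ D D′) (j-minimal (_·_ {G} {G′} D D′) (·-solvable G G′ S S′ D D′ solD solD′))
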